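{- Let $n\ge 3$ and let $\mathbf{z}_1=\overline{110}[n]$, $\mathbf{z}_2=\overline{011}[n]$, $\mathbf{z}_3=\overline{101}[n]$. (i) If $n\equiv 0$ or $2\pmod 3$, then $|T(\mathbf{z}_i)|=n(n+1)/3$ for all $i\in\{1,2,3\}$. (ii) If $n\equiv 1\pmod 3$, then $|T(\mathbf{z}_1)|=|T(\mathbf{z}_3)|=(n-1)(n+2)/3+1$ and $|T(\mathbf{z}_2)|=(n-1)(n+2)/3$.
   Context: For $\mathbf{x}=(x_0,\ldots,x_{n-1})\in\mathbb{F}_2^n$, the derivative is $\partial\mathbf{x}=(x_0+x_1,\ldots,x_{n-2}+x_{n-1})\in\mathbb{F}_2^{n-1}$, with $\partial^0\mathbf{x}=\mathbf{x}$ and $\partial^i\mathbf{x}=\partial(\partial^{i-1}\mathbf{x})$. The Steinhaus triangle is $T(\mathbf{x})=(\mathbf{x},\partial\mathbf{x},\ldots,\partial^{n-1}\mathbf{x})$; $|\mathbf{y}|$ is the number of ones of a binary sequence and $|T(\mathbf{x})|=\sum_{i=0}^{n-1}|\partial^i\mathbf{x}|$. $\overline{x_1\cdots x_p}[k]$ is the word of the first $k$ letters of the infinite periodic word $x_1\cdots x_px_1\cdots x_p\cdots$. -}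

module Defs where

open import Data.Bool using (Bool; true; false; _xor_)
open import Data.Nat using (ℕ; zero; suc; _+_)
open import Data.List using (List; []; _∷_; map; length)
open import Data.Nat.ListAction using (sum)

-- binary words over F₂ are lists of Bool (true = 1), addition in F₂ is xor

∂ : List Bool → List Bool
∂ [] = []
∂ (x ∷ []) = []
∂ (x ∷ y ∷ xs) = (x xor y) ∷ ∂ (y ∷ xs)

∂^ : ℕ → List Bool → List Bool
∂^ zero x = x
∂^ (suc i) x = ∂ (∂^ i x)

steinhausRows : ℕ → List Bool → List (List Bool)
steinhausRows zero x = []
steinhausRows (suc k) x = x ∷ steinhausRows k (∂ x)

T : List Bool → List (List Bool)
T x = steinhausRows (length x) x

weight : List Bool → ℕ
weight [] = 0
weight (true ∷ xs) = suc (weight xs)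
weight (false ∷ xs) = weight xs

weightT : List Bool → ℕ
weightT x = sum (map weight (T x))

-- periodic word: first k letters of the infinite word w w w …
-- (pattern given as three letters a b c)
periodic3 : Bool → Bool → Bool → ℕ → List Bool
periodic3 a b c zero = []
periodic3 a b c (suc k) = a ∷ periodic3 b c a k

-- A period-3 word whose letters sum to zero in F₂ is differentiated into the same word with
-- its period rotated, so the rows of its Steinhaus triangle run through the three rotations
-- of the period. The three rotations of a period of weight 2 carry 2m ones altogether at
-- length m, hence rows n+3, n+2, n+1 together carry 2n+4 ones and f(n+3) = f(n) + 2n + 4 for
-- each of the three triangles f. Thus 3 f(n) − n(n+1) depends only on n mod 3, and the
-- cases n = 0, 1, 2 are computed directly.
module Submission where

open import Defs
open import Data.Bool using (Bool; true; false; _xor_)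
open import Data.Bool.Properties using (xor-comm; xor-assoc)
open import Data.Nat using (ℕ; zero; suc; pred; _+_; _*_; _∸_; _≤_; _/_; _%_)
open import Data.Nat.DivMod using (m≡m%n+[m/n]*n; m*n/n≡m; +-distrib-/-∣ʳ)
open import Data.Nat.Divisibility using (∣-refl)
open import Data.Nat.Properties using (+-comm; +-assoc; *-comm; +-identityʳ; +-cancelʳ-≡)
open import Data.Nat.Tactic.RingSolver using (solve-∀)
open import Data.List using ([]; _∷_; map; length)
open import Data.Nat.ListAction using (sum)
open import Data.Product using (_×_; _,_)
open import Data.Sum using (_⊎_; inj₁; inj₂)
open import Relation.Binary.PropositionalEquality
  using (_≡_; refl; sym; trans; cong; cong₂; subst; module ≡-Reasoning)
open ≡-Reasoning

bit : Bool → ℕ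
bit true = 1
bit false = 0

weight-∷ : ∀ b xs → weight (b ∷ xs) ≡ bit b + weight xs
weight-∷ true xs = refl
weight-∷ false xs = refl

length-∂ : ∀ xs → length (∂ xs) ≡ pred (length xs)
length-∂ [] = refl
length-∂ (x ∷ []) = refl
length-∂ (x ∷ y ∷ xs) = cong suc (length-∂ (y ∷ xs))

weightT-∷ : ∀ x xs → weightT (x ∷ xs) ≡ weight (x ∷ xs) + weightT (∂ (x ∷ xs))
weightT-∷ x xs = cong (λ k → weight (x ∷ xs) + sum-rows k) (sym (length-∂ (x ∷ xs)))
  where
  sum-rows : ℕ → ℕ
  sum-rows k = sum (map weight (steinhausRows k (∂ (x ∷ xs))))

∂-periodic3 : ∀ a b c k →
  ∂ (periodic3 a b c (suc k)) ≡ periodic3 (a xor b) (b xor c) (c xor a) k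
∂-periodic3 a b c zero = refl
∂-periodic3 a b c (suc k) = cong ((a xor b) ∷_) (∂-periodic3 b c a k)

ZeroSum : Bool → Bool → Bool → Set
ZeroSum a b c = a xor b xor c ≡ false

zeroSum-rotate : ∀ a b c → ZeroSum a b c → ZeroSum c a b
zeroSum-rotate a b c sum≡0 = trans (xor-comm c (a xor b)) (trans (xor-assoc a b c) sum≡0)

-- The four omitted periods have odd weight, so their ZeroSum hypothesis is absurd.
∂-periodic3-zeroSum : ∀ a b c → ZeroSum a b c → ∀ k →
  ∂ (periodic3 a b c (suc k)) ≡ periodic3 c a b k
∂-periodic3-zeroSum false false false _ = ∂-periodic3 false false false
∂-periodic3-zeroSum false true true _ = ∂-periodic3 false true true
∂-periodic3-zeroSum true false true _ = ∂-periodic3 true false true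
∂-periodic3-zeroSum true true false _ = ∂-periodic3 true true false

weightT-periodic3-zeroSum : ∀ a b c → ZeroSum a b c → ∀ k →
  weightT (periodic3 a b c (suc k)) ≡ weight (periodic3 a b c (suc k)) + weightT (periodic3 c a b k)
weightT-periodic3-zeroSum a b c s k =
  trans (weightT-∷ a (periodic3 b c a k))
        (cong (λ w → weight (periodic3 a b c (suc k)) + weightT w) (∂-periodic3-zeroSum a b c s k))

weight-rotations : ∀ a b c m →
  weight (periodic3 a b c m) + weight (periodic3 b c a m) + weight (periodic3 c a b m)
    ≡ m * (bit a + bit b + bit c)
weight-rotations a b c zero = refl
weight-rotations a b c (suc m) = begin
  weight (a ∷ periodic3 b c a m) + weight (b ∷ periodic3 c a b m) + weight (c ∷ periodic3 a b c m)
    ≡⟨ cong₂ _+_ (cong₂ _+_ (weight-∷ a _) (weight-∷ b _)) (weight-∷ c _) ⟩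
  (bit a + u) + (bit b + v) + (bit c + w)
    ≡⟨ regroup (bit a) (bit b) (bit c) u v w ⟩
  (bit a + bit b + bit c) + (u + v + w)
    ≡⟨ cong ((bit a + bit b + bit c) +_) (weight-rotations b c a m) ⟩
  (bit a + bit b + bit c) + m * (bit b + bit c + bit a)
    ≡⟨ rotate (bit a) (bit b) (bit c) m ⟩
  suc m * (bit a + bit b + bit c) ∎
  where
  u v w : ℕ
  u = weight (periodic3 b c a m)
  v = weight (periodic3 c a b m)
  w = weight (periodic3 a b c m)
  regroup : ∀ x y z u v w → (x + u) + (y + v) + (z + w) ≡ (x + y + z) + (u + v + w)
  regroup = solve-∀
  rotate : ∀ x y z m → (x + y + z) + m * (y + z + x) ≡ suc m * (x + y + z)
  rotate = solve-∀

weightT-periodic3-+3 : ∀ a b c → ZeroSum a b c → ∀ k →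
  weightT (periodic3 a b c (3 + k)) ≡ (2 + k) * (bit a + bit b + bit c) + weightT (periodic3 a b c k)
weightT-periodic3-+3 a b c s k = begin
  weightT (periodic3 a b c (3 + k))
    ≡⟨ weightT-periodic3-zeroSum a b c s (2 + k) ⟩
  row₀ + weightT (periodic3 c a b (2 + k))
    ≡⟨ cong (row₀ +_) (weightT-periodic3-zeroSum c a b s′ (1 + k)) ⟩
  row₀ + (row₁ + weightT (periodic3 b c a (1 + k)))
    ≡⟨ cong (λ r → row₀ + (row₁ + r)) (weightT-periodic3-zeroSum b c a s″ k) ⟩
  row₀ + (row₁ + (y + t))
    ≡⟨ cong₂ (λ p q → p + (q + (y + t))) (trans (weight-∷ a _) (cong (bit a +_) (weight-∷ b _))) (weight-∷ c _) ⟩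
  (bit a + (bit b + x)) + ((bit c + z) + (y + t))
    ≡⟨ regroup (bit a) (bit b) (bit c) x y z t ⟩
  (bit a + bit b + bit c) + (x + z + y) + t
    ≡⟨ cong (λ r → (bit a + bit b + bit c) + r + t) (weight-rotations c a b (1 + k)) ⟩
  (bit a + bit b + bit c) + (1 + k) * (bit c + bit a + bit b) + t
    ≡⟨ collect (bit a) (bit b) (bit c) k t ⟩
  (2 + k) * (bit a + bit b + bit c) + t ∎
  where
  s′ : ZeroSum c a b
  s′ = zeroSum-rotate a b c s
  s″ : ZeroSum b c a
  s″ = zeroSum-rotate c a b s′
  row₀ row₁ x y z t : ℕ
  row₀ = weight (a ∷ b ∷ periodic3 c a b (1 + k))
  row₁ = weight (c ∷ periodic3 a b c (1 + k))
  x = weight (periodic3 c a b (1 + k))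
  y = weight (periodic3 b c a (1 + k))
  z = weight (periodic3 a b c (1 + k))
  t = weightT (periodic3 a b c k)
  regroup : ∀ p q r x y z t → (p + (q + x)) + ((r + z) + (y + t)) ≡ (p + q + r) + (x + z + y) + t
  regroup = solve-∀
  collect : ∀ p q r k t → (p + q + r) + (1 + k) * (r + p + q) + t ≡ (2 + k) * (p + q + r) + t
  collect = solve-∀

3*m≡n⇒m≡n/3 : ∀ {m n} → 3 * m ≡ n → m ≡ n / 3
3*m≡n⇒m≡n/3 {m} 3m≡n = trans (sym (m*n/n≡m m 3)) (cong (_/ 3) (trans (*-comm m 3) 3m≡n))

n*[n+1]≡[n∸1]*[n+2]+2 : ∀ m → suc m * (suc m + 1) ≡ (suc m ∸ 1) * (suc m + 2) + 2
n*[n+1]≡[n∸1]*[n+2]+2 = identity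
  where
  identity : ∀ m → suc m * (suc m + 1) ≡ m * (suc m + 2) + 2
  identity = solve-∀

module ThreeStep (f : ℕ → ℕ) (f-+3 : ∀ k → f (3 + k) ≡ (2 + k) * 2 + f k) where

  -- 3 f(k) − k(k+1) = e − d, stated without truncated subtraction.
  ClosedForm : ℕ → ℕ → ℕ → Set
  ClosedForm d e k = 3 * f k + d ≡ k * (k + 1) + e

  closedForm-+3 : ∀ {d e} k → ClosedForm d e k → ClosedForm d e (3 + k)
  closedForm-+3 {d} {e} k hyp = begin
    3 * f (3 + k) + d            ≡⟨ cong (λ v → 3 * v + d) (f-+3 k) ⟩
    3 * ((2 + k) * 2 + f k) + d  ≡⟨ expand k (f k) d ⟩
    (6 * k + 12) + (3 * f k + d) ≡⟨ cong ((6 * k + 12) +_) hyp ⟩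
    (6 * k + 12) + (k * (k + 1) + e) ≡⟨ collect k e ⟩
    (3 + k) * (3 + k + 1) + e    ∎
    where
    expand : ∀ k v d → 3 * ((2 + k) * 2 + v) + d ≡ (6 * k + 12) + (3 * v + d)
    expand = solve-∀
    collect : ∀ k e → (6 * k + 12) + (k * (k + 1) + e) ≡ (3 + k) * (3 + k + 1) + e
    collect = solve-∀

  closedForm-*3+ : ∀ {d e r} q → ClosedForm d e r → ClosedForm d e (q * 3 + r)
  closedForm-*3+ zero base = base
  closedForm-*3+ {r = r} (suc q) base = closedForm-+3 (q * 3 + r) (closedForm-*3+ q base)

  closedForm-%3 : ∀ {d e r} n → n % 3 ≡ r → ClosedForm d e r → ClosedForm d e n
  closedForm-%3 {r = r} n n%3≡r base = subst (ClosedForm _ _) q*3+r≡n (closedForm-*3+ (n / 3) base)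
    where
    q*3+r≡n : n / 3 * 3 + r ≡ n
    q*3+r≡n = begin
      n / 3 * 3 + r     ≡⟨ +-comm (n / 3 * 3) r ⟩
      r + n / 3 * 3     ≡⟨ cong (_+ n / 3 * 3) (sym n%3≡r) ⟩
      n % 3 + n / 3 * 3 ≡⟨ sym (m≡m%n+[m/n]*n n 3) ⟩
      n                 ∎

  f[n]≡n*[n+1]/3 : ∀ {r} n → n % 3 ≡ r → ClosedForm 0 0 r → f n ≡ n * (n + 1) / 3
  f[n]≡n*[n+1]/3 n n%3≡r base = 3*m≡n⇒m≡n/3 (begin
    3 * f n           ≡⟨ sym (+-identityʳ (3 * f n)) ⟩
    3 * f n + 0       ≡⟨ closedForm-%3 n n%3≡r base ⟩
    n * (n + 1) + 0   ≡⟨ +-identityʳ (n * (n + 1)) ⟩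
    n * (n + 1)       ∎)

  f[n]≡[n∸1]*[n+2]/3+1 : ∀ n → n % 3 ≡ 1 → ClosedForm 0 1 1 → f n ≡ (n ∸ 1) * (n + 2) / 3 + 1
  f[n]≡[n∸1]*[n+2]/3+1 n@(suc m) n%3≡1 base = begin
    f n                          ≡⟨ 3*m≡n⇒m≡n/3 3f[n]≡p+3 ⟩
    (p + 3) / 3                  ≡⟨ +-distrib-/-∣ʳ p ∣-refl ⟩
    p / 3 + 1                    ∎
    where
    p : ℕ
    p = (n ∸ 1) * (n + 2)
    3f[n]≡p+3 : 3 * f n ≡ p + 3
    3f[n]≡p+3 = begin
      3 * f n             ≡⟨ sym (+-identityʳ (3 * f n)) ⟩
      3 * f n + 0         ≡⟨ closedForm-%3 n n%3≡1 base ⟩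
      n * (n + 1) + 1     ≡⟨ cong (_+ 1) (n*[n+1]≡[n∸1]*[n+2]+2 m) ⟩
      p + 2 + 1           ≡⟨ +-assoc p 2 1 ⟩
      p + 3               ∎

  f[n]≡[n∸1]*[n+2]/3 : ∀ n → n % 3 ≡ 1 → ClosedForm 2 0 1 → f n ≡ (n ∸ 1) * (n + 2) / 3
  f[n]≡[n∸1]*[n+2]/3 n@(suc m) n%3≡1 base = 3*m≡n⇒m≡n/3 (+-cancelʳ-≡ 2 (3 * f n) p (begin
    3 * f n + 2         ≡⟨ closedForm-%3 n n%3≡1 base ⟩
    n * (n + 1) + 0     ≡⟨ +-identityʳ (n * (n + 1)) ⟩
    n * (n + 1)         ≡⟨ n*[n+1]≡[n∸1]*[n+2]+2 m ⟩
    p + 2               ∎))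
    where
    p : ℕ
    p = (n ∸ 1) * (n + 2)

module Pattern110 = ThreeStep (λ k → weightT (periodic3 true true false k))
                              (weightT-periodic3-+3 true true false refl)
module Pattern011 = ThreeStep (λ k → weightT (periodic3 false true true k))
                              (weightT-periodic3-+3 false true true refl)
module Pattern101 = ThreeStep (λ k → weightT (periodic3 true false true k))
                              (weightT-periodic3-+3 true false true refl)

proposition7p4 : (n : ℕ) → 3 ≤ n →
    ((n % 3 ≡ 0 ⊎ n % 3 ≡ 2) →
      (weightT (periodic3 true true false n) ≡ (n * (n + 1)) / 3)
      × (weightT (periodic3 false true true n) ≡ (n * (n + 1)) / 3)
      × (weightT (periodic3 true false true n) ≡ (n * (n + 1)) / 3))
    × (n % 3 ≡ 1 →
      (weightT (periodic3 true true false n) ≡ ((n ∸ 1) * (n + 2)) / 3 + 1)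
      × (weightT (periodic3 true false true n) ≡ ((n ∸ 1) * (n + 2)) / 3 + 1)
      × (weightT (periodic3 false true true n) ≡ ((n ∸ 1) * (n + 2)) / 3))
proposition7p4 n _ =
    (λ { (inj₁ n%3≡0) → Pattern110.f[n]≡n*[n+1]/3 n n%3≡0 refl
                      , Pattern011.f[n]≡n*[n+1]/3 n n%3≡0 refl
                      , Pattern101.f[n]≡n*[n+1]/3 n n%3≡0 refl
       ; (inj₂ n%3≡2) → Pattern110.f[n]≡n*[n+1]/3 n n%3≡2 refl
                      , Pattern011.f[n]≡n*[n+1]/3 n n%3≡2 refl
                      , Pattern101.f[n]≡n*[n+1]/3 n n%3≡2 refl })
  , λ n%3≡1 → Pattern110.f[n]≡[n∸1]*[n+2]/3+1 n n%3≡1 refl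
            , Pattern101.f[n]≡[n∸1]*[n+2]/3+1 n n%3≡1 refl
            , Pattern011.f[n]≡[n∸1]*[n+2]/3 n n%3≡1 refl
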